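{- Let $t\ge2$ and consider an edge coloring of $K_n$ with colors $\{1,\ldots,t\}$, with color classes $H_1,\ldots,H_t$ (spanning subgraphs), such that $H_j$ is regular for every $j\geq 3$. Let $u,v$ be distinct vertices and let $X=\{x^{(1)}_{0},\ldots,x^{(|X|)}_{0}\}\subseteq N_{H_{1}}(v)\setminus N_{H_{1}}(u)$. If \[\deg_{H_{1}}(u)\geq \deg_{H_{1}}(v)-|N_{H_{2}}(u)\cap N_{H_{1}}(v)|+|X\cap N_{H_{2}}(u)|,\] then there exist $L^{(1)},\ldots,L^{(|X|)}$ such that each $L^{(j)}$ is a $vx^{(j)}_{0}$ and $x^{(j)}_{0}u$ exchange and $\mathcal{X}(L^{(j)})\cap \mathcal{X}(L^{(i)})=\emptyset$ for all $i\neq j$.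
   Context: For distinct vertices $u,v$ and vertex $x_0$, a $vx_0$ and $x_0u$ exchange is a list of $2l$ distinct edges $L=(vx_{0},x_{0}u,vx_{1},x_{1}u,\ldots,vx_{l-1},x_{l-1}u)$ of $K_n$ (some $l\ge1$) such that $x_{i}u$ and $vx_{i+1}$ have the same color for all $i$ modulo $l$; $\mathcal{X}(L)=\{x_0,\ldots,x_{l-1}\}$. $N_H(w)$ and $\deg_H(w)$ denote neighborhood and degree of $w$ in $H$. -}

module Defs where

open import Data.Nat using (ℕ; _≤_; _≟_)
open import Data.Fin using (Fin) renaming (_≟_ to _≟ᶠ_)
open import Data.Fin.Subset using (Subset; inside; outside)
open import Data.Vec using (tabulate)
open import Data.Bool using (if_then_else_)
open import Data.List using (List; []; _∷_; _++_; [_]; concatMap; zip)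
open import Data.List.Relation.Unary.All using (All)
open import Data.List.Relation.Unary.AllPairs using (AllPairs)
open import Data.Product using (_×_; _,_; ∃)
open import Data.Sum using (_⊎_)
open import Relation.Nullary using (¬_; does)
open import Relation.Binary.PropositionalEquality using (_≡_)

-- An edge colouring of K_n with colours {1,…,t}
-- is a symmetric function c on pairs of vertices whose value on every pair of
-- distinct vertices lies in {1,…,t} (values on the diagonal are irrelevant).
IsEdgeColouring : (n t : ℕ) → (Fin n → Fin n → ℕ) → Set
IsEdgeColouring n t c =
  (∀ x y → c x y ≡ c y x) ×
  (∀ x y → ¬ x ≡ y → (1 ≤ c x y) × (c x y ≤ t))

N : {n : ℕ} → (Fin n → Fin n → ℕ) → ℕ → Fin n → Subset n
N c j w = tabulate λ y →
  if does (y ≟ᶠ w) then outside else (if does (c w y ≟ j) then inside else outside)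

deg : {n : ℕ} → (Fin n → Fin n → ℕ) → ℕ → Fin n → ℕ
deg c j w = Data.Fin.Subset.∣ N c j w ∣

Regular : {n : ℕ} → (Fin n → Fin n → ℕ) → ℕ → Set
Regular {n} c j = ∃ λ d → ∀ (w : Fin n) → deg c j w ≡ d

-- Edges of K_n as ordered pairs; two pairs are the same edge if they agree as
-- unordered pairs.
Edge : ℕ → Set
Edge n = Fin n × Fin n

IsEdge : {n : ℕ} → Edge n → Set
IsEdge (a , b) = ¬ a ≡ b

SameEdge : {n : ℕ} → Edge n → Edge n → Set
SameEdge (a , b) (c , d) = ((a ≡ c) × (b ≡ d)) ⊎ ((a ≡ d) × (b ≡ c))

exchangeEdges : {n : ℕ} → Fin n → Fin n → List (Fin n) → List (Edge n)
exchangeEdges u v xs = concatMap (λ x → (v , x) ∷ (x , u) ∷ []) xs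

-- cyclic successor pairing: (x_i , x_{i+1 mod l})
rotate : {A : Set} → List A → List A
rotate []       = []
rotate (x ∷ xs) = xs ++ [ x ]

-- xs = (x₀,…,x_{l-1}) encodes a "v x₀ and x₀ u exchange" L (with 𝒳(L) the
-- entries of xs): l ≥ 1 with first entry x₀, the 2l listed pairs are edges of
-- K_n and pairwise distinct, and colour(x_i u) = colour(v x_{i+1}) (i mod l).
IsExchange : {n : ℕ} → (Fin n → Fin n → ℕ) → (u v x₀ : Fin n) → List (Fin n) → Set
IsExchange c u v x₀ []       = Data.Empty.⊥
  where import Data.Empty
IsExchange c u v x₀ (y ∷ ys) =
  (y ≡ x₀) ×
  All IsEdge (exchangeEdges u v (y ∷ ys)) ×
  AllPairs (λ e f → ¬ SameEdge e f) (exchangeEdges u v (y ∷ ys)) ×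
  All (λ p → c (Data.Product.proj₁ p) u ≡ c v (Data.Product.proj₂ p))
      (zip (y ∷ ys) (rotate (y ∷ ys)))

-- Write colᵤ y = c(y,u) and colᵥ y = c(v,y); an exchange from x₀ is a cycle x₀, …, x_{l-1} of
-- vertices outside {u, v} with colᵤ xᵢ = colᵥ xᵢ₊₁.  Regularity of H_j for j ≥ 3 gives, for each
-- such j, as many vertices y ∉ {u, v} with colᵤ y = j as with colᵥ y = j; since both colourings
-- partition the same vertices, colours 1 and 2 balance jointly, and the degree hypothesis then leaves
-- enough vertices with colᵥ = 2.  Hence there is an injection σ with colᵥ (σ y) = colᵤ y from the
-- vertices y ∉ {u, v} with colᵤ y ≠ 1 that lie in X or have colᵥ y ≠ 1, to the vertices ∉ {u, v}.
-- Follow σ from x ∈ X.  As colᵥ x = 1, x is not in the image of σ, so by injectivity the walk never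
-- repeats a vertex; it must therefore stop, at a vertex of colᵤ = 1 = colᵥ x, which closes the cycle.
-- For the same reason walks from distinct points of X are disjoint.

module Submission where

open import Data.Nat using (ℕ)
open import Data.Fin using (Fin)
open import Level using (0ℓ)
open import Relation.Unary using (Pred; Decidable)
open import Relation.Binary.PropositionalEquality using (_≡_)

module Counting where

  open import Data.Nat using (ℕ; zero; suc; _+_; _≤_; _<_; z≤n; s≤s; s≤s⁻¹)
  import Data.Nat as ℕ
  open import Data.Nat.Properties
    using (≤-reflexive; ≤-trans; ≤-antisym; m≤n⇒m≤1+n; ≤∧≢⇒<; <⇒≢; +-suc; module ≤-Reasoning)
  open import Data.Fin using (Fin; zero; suc; _≟_)
  open import Data.Fin.Properties using (0≢1+n; suc-injective)
  open import Data.Product using (_×_; _,_; proj₁; proj₂; Σ-syntax)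
  open import Data.Bool using (if_then_else_)
  open import Function using (_∘_; id; const; flip)
  open import Data.List using (List; []; _∷_; length)
  open import Data.List.Relation.Unary.Any using (here; there)
  import Data.List.Membership.DecPropositional as DecMembership
  open import Data.List.Membership.Propositional using (_∈_)
  open import Data.List.Relation.Unary.Unique.Propositional using (Unique; []; _∷_)
  open import Data.List.Relation.Unary.Unique.Propositional.Properties using (Unique[x∷xs]⇒x∉xs)
  open import Level using (0ℓ)
  open import Relation.Nullary using (does; yes; no; contradiction)
  open import Relation.Unary using (Pred; Decidable; _⊆_; _≐_; _∩_; ∁; Empty; Satisfiable)
  open import Relation.Unary.Properties using (_∩?_; ∁?)
  open import Relation.Binary.PropositionalEquality

  private
    variable
      n : ℕ

  count : {P : Pred (Fin n) 0ℓ} → Decidable P → ℕ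
  count {zero}  P? = 0
  count {suc n} P? = (if does (P? zero) then suc else id) (count (P? ∘ suc))

  count≤n : {P : Pred (Fin n) 0ℓ} (P? : Decidable P) → count P? ≤ n
  count≤n {zero}  P? = z≤n
  count≤n {suc n} P? with P? zero
  ... | yes _ = s≤s (count≤n (P? ∘ suc))
  ... | no  _ = m≤n⇒m≤1+n (count≤n (P? ∘ suc))

  count-empty : {P : Pred (Fin n) 0ℓ} (P? : Decidable P) → Empty P → count P? ≡ 0
  count-empty {zero}  P? _ = refl
  count-empty {suc n} P? ∅ with P? zero
  ... | yes p = contradiction p (∅ zero)
  ... | no  _ = count-empty (P? ∘ suc) (∅ ∘ suc)

  count-mono : {P Q : Pred (Fin n) 0ℓ} (P? : Decidable P) (Q? : Decidable Q) →
               P ⊆ Q → count P? ≤ count Q?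
  count-mono {zero}  P? Q? _ = z≤n
  count-mono {suc n} P? Q? P⊆Q with P? zero | Q? zero
  ... | yes p | no ¬q = contradiction (P⊆Q p) ¬q
  ... | yes _ | yes _ = s≤s (count-mono (P? ∘ suc) (Q? ∘ suc) P⊆Q)
  ... | no  _ | yes _ = m≤n⇒m≤1+n (count-mono (P? ∘ suc) (Q? ∘ suc) P⊆Q)
  ... | no  _ | no  _ = count-mono (P? ∘ suc) (Q? ∘ suc) P⊆Q

  count-cong : {P Q : Pred (Fin n) 0ℓ} (P? : Decidable P) (Q? : Decidable Q) →
               P ≐ Q → count P? ≡ count Q?
  count-cong P? Q? (P⊆Q , Q⊆P) = ≤-antisym (count-mono P? Q? P⊆Q) (count-mono Q? P? Q⊆P)

  count-satisfiable : {P : Pred (Fin n) 0ℓ} (P? : Decidable P) → 0 < count P? → Satisfiable P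
  count-satisfiable {suc n} P? 0<count with P? zero
  ... | yes p = zero , p
  ... | no  _ with count-satisfiable (P? ∘ suc) 0<count
  ...   | x , p = suc x , p

  count-split : {P Q : Pred (Fin n) 0ℓ} (P? : Decidable P) (Q? : Decidable Q) →
                count P? ≡ count (P? ∩? Q?) + count (P? ∩? ∁? Q?)
  count-split {zero}  P? Q? = refl
  count-split {suc n} P? Q?
    with P? zero | Q? zero | count-split (P? ∘ suc) (Q? ∘ suc)
  ... | yes _ | yes _ | ih = cong suc ih
  ... | yes _ | no  _ | ih = trans (cong suc ih) (sym (+-suc _ _))
  ... | no  _ | yes _ | ih = ih
  ... | no  _ | no  _ | ih = ih

  count-singleton : {P : Pred (Fin n) 0ℓ} (P? : Decidable P) {x : Fin n} →
                    P x → (∀ {y} → P y → y ≡ x) → count P? ≡ 1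
  count-singleton {suc n} P? {zero} p unique with P? zero
  ... | yes _  = cong suc (count-empty (P? ∘ suc) λ y p′ → 0≢1+n (sym (unique p′)))
  ... | no ¬p  = contradiction p ¬p
  count-singleton {suc n} P? {suc x} p unique with P? zero
  ... | yes p₀ = contradiction (unique p₀) 0≢1+n
  ... | no  _  = count-singleton (P? ∘ suc) p (suc-injective ∘ unique)

  count-remove : {P : Pred (Fin n) 0ℓ} (P? : Decidable P) {x : Fin n} → P x →
                 count P? ≡ suc (count (P? ∩? ∁? (_≟ x)))
  count-remove P? {x} p = trans (count-split P? (_≟ x))
    (cong (_+ count (P? ∩? ∁? (_≟ x))) (count-singleton (P? ∩? (_≟ x)) (p , refl) proj₂))

  count-point-cong : {P Q : Pred (Fin n) 0ℓ} (P? : Decidable P) (Q? : Decidable Q) {x y : Fin n} →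
                     (P x → Q y) → (Q y → P x) →
                     count (P? ∩? (_≟ x)) ≡ count (Q? ∩? (_≟ y))
  count-point-cong P? Q? {x} {y} P⇒Q Q⇒P with P? x
  ... | yes p = trans (count-singleton (P? ∩? (_≟ x)) (p , refl) proj₂)
                  (sym (count-singleton (Q? ∩? (_≟ y)) (P⇒Q p , refl) proj₂))
  ... | no ¬p = trans (count-empty (P? ∩? (_≟ x)) λ { _ (p , refl) → ¬p p })
                  (sym (count-empty (Q? ∩? (_≟ y)) λ { _ (q , refl) → ¬p (Q⇒P q) }))

  module _ {m : ℕ} where
    open DecMembership (_≟_ {m}) using (_∈?_)

    unique⇒length≤ : {xs : List (Fin m)} → Unique xs → length xs ≤ m
    unique⇒length≤ {xs = xs} unique = ≤-trans (length≤count unique) (count≤n (_∈? xs))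
      where
      length≤count : {xs : List (Fin m)} → Unique xs → length xs ≤ count (_∈? xs)
      length≤count [] = z≤n
      length≤count {xs = x ∷ xs} unique@(_ ∷ unique′) = begin
        suc (length xs)      ≤⟨ s≤s (length≤count unique′) ⟩
        suc (count (_∈? xs)) ≤⟨ s≤s (count-mono (_∈? xs) xs∖x? xs⊆xs∖x) ⟩
        suc (count xs∖x?)    ≡⟨ count-remove (_∈? (x ∷ xs)) (here refl) ⟨
        count (_∈? (x ∷ xs)) ∎
        where
        open ≤-Reasoning
        xs∖x? = (_∈? (x ∷ xs)) ∩? ∁? (_≟ x)
        xs⊆xs∖x : ∀ {z} → z ∈ xs → z ∈ x ∷ xs × z ≢ x
        xs⊆xs∖x z∈xs = there z∈xs , λ { refl → Unique[x∷xs]⇒x∉xs unique z∈xs }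

  module _ {P : Pred (Fin n) 0ℓ} (P? : Decidable P) (ℓ : Fin n → ℕ) where

    labelled : ℕ → ℕ
    labelled k = count (P? ∩? λ x → ℓ x ℕ.≟ k)

    labelled-below : ℕ → ℕ
    labelled-below m = count (P? ∩? λ x → ℓ x ℕ.<? m)

    labelled-below-zero : labelled-below 0 ≡ 0
    labelled-below-zero = count-empty (P? ∩? λ x → ℓ x ℕ.<? 0) λ { _ (_ , ()) }

    labelled-below-suc : ∀ m → labelled-below (suc m) ≡ labelled m + labelled-below m
    labelled-below-suc m = trans (count-split below-1+m (λ x → ℓ x ℕ.≟ m)) (cong₂ _+_
      (count-cong (below-1+m ∩? λ x → ℓ x ℕ.≟ m) (P? ∩? λ x → ℓ x ℕ.≟ m)
        ( (λ ((p , _) , ℓx≡m) → p , ℓx≡m)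
        , (λ (p , ℓx≡m) → (p , s≤s (≤-reflexive ℓx≡m)) , ℓx≡m)))
      (count-cong (below-1+m ∩? ∁? λ x → ℓ x ℕ.≟ m) (P? ∩? λ x → ℓ x ℕ.<? m)
        ( (λ ((p , ℓx<1+m) , ℓx≢m) → p , ≤∧≢⇒< (s≤s⁻¹ ℓx<1+m) ℓx≢m)
        , (λ (p , ℓx<m) → (p , m≤n⇒m≤1+n ℓx<m) , <⇒≢ ℓx<m))))
      where
      below-1+m : Decidable (P ∩ λ x → ℓ x < suc m)
      below-1+m = P? ∩? λ x → ℓ x ℕ.<? suc m

    count-labelled-below : ∀ {m} → (∀ {x} → P x → ℓ x < m) → count P? ≡ labelled-below m
    count-labelled-below {m} bound =
      count-cong P? (P? ∩? λ x → ℓ x ℕ.<? m) ((λ p → p , bound p) , proj₁)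

  count-≡-by-label : {P₁ P₂ : Pred (Fin n) 0ℓ} (P₁? : Decidable P₁) (P₂? : Decidable P₂)
                     (ℓ₁ ℓ₂ : Fin n → ℕ) (m : ℕ) →
                     (∀ {x} → P₁ x → ℓ₁ x < m) → (∀ {x} → P₂ x → ℓ₂ x < m) →
                     (∀ k → labelled P₁? ℓ₁ k ≡ labelled P₂? ℓ₂ k) →
                     count P₁? ≡ count P₂?
  count-≡-by-label P₁? P₂? ℓ₁ ℓ₂ m bound₁ bound₂ classes≡ =
    trans (count-labelled-below P₁? ℓ₁ bound₁)
      (trans (below m) (sym (count-labelled-below P₂? ℓ₂ bound₂)))
    where
    below : ∀ m → labelled-below P₁? ℓ₁ m ≡ labelled-below P₂? ℓ₂ m
    below zero    = trans (labelled-below-zero P₁? ℓ₁) (sym (labelled-below-zero P₂? ℓ₂))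
    below (suc m) = trans (labelled-below-suc P₁? ℓ₁ m)
      (trans (cong₂ _+_ (classes≡ m) (below m)) (sym (labelled-below-suc P₂? ℓ₂ m)))

  module _ {P : Pred (Fin n) 0ℓ} (P? : Decidable P) (ℓ : Fin n → ℕ) {a : ℕ} where

    private
      P∖a? : Decidable (P ∩ ∁ λ x → ℓ x ≡ a)
      P∖a? = P? ∩? ∁? λ x → ℓ x ℕ.≟ a

    labelled-∖-same : labelled P∖a? ℓ a ≡ 0
    labelled-∖-same =
      count-empty (P∖a? ∩? λ x → ℓ x ℕ.≟ a) λ _ ((_ , ℓx≢a) , ℓx≡a) → ℓx≢a ℓx≡a

    labelled-∖-other : ∀ {k} → k ≢ a → labelled P∖a? ℓ k ≡ labelled P? ℓ k
    labelled-∖-other {k} k≢a = count-cong (P∖a? ∩? λ x → ℓ x ℕ.≟ k) (P? ∩? λ x → ℓ x ℕ.≟ k)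
      ( (λ ((p , _) , ℓx≡k) → p , ℓx≡k)
      , (λ (p , ℓx≡k) → (p , λ ℓx≡a → k≢a (trans (sym ℓx≡k) ℓx≡a)) , ℓx≡k))

  record _↣_ {n m : ℕ} (P : Pred (Fin n) 0ℓ) (Q : Pred (Fin m) 0ℓ) : Set where
    field
      to        : Fin n → Fin m
      to-∈      : ∀ {x} → P x → Q (to x)
      injective : ∀ {x y} → P x → P y → to x ≡ to y → x ≡ y

  open _↣_ public

  ↣-cons : {m : ℕ} {P : Pred (Fin (suc n)) 0ℓ} {Q R : Pred (Fin m) 0ℓ} (y₀ : Fin m) →
           (P zero → Q y₀) → (∀ {y} → R y → Q y) → (P zero → ∀ {y} → R y → y ≢ y₀) →
           (λ x → P (suc x)) ↣ R → P ↣ Q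
  ↣-cons {P = P} {Q} {R} y₀ head R⊆Q fresh f =
    record { to = to′ ; to-∈ = to′-∈ ; injective = to′-inj }
    where
    to′ : Fin _ → _
    to′ zero    = y₀
    to′ (suc x) = to f x
    to′-∈ : ∀ {x} → P x → Q (to′ x)
    to′-∈ {zero}  p = head p
    to′-∈ {suc x} p = R⊆Q (to-∈ f p)
    to′-inj : ∀ {x y} → P x → P y → to′ x ≡ to′ y → x ≡ y
    to′-inj {zero}  {zero}  _ _ _  = refl
    to′-inj {zero}  {suc y} p q eq = contradiction (sym eq) (fresh p (to-∈ f q))
    to′-inj {suc x} {zero}  p q eq = contradiction eq (fresh q (to-∈ f p))
    to′-inj {suc x} {suc y} p q eq = cong suc (injective f p q eq)

  -- The injection is a total map; the given point is its value outside P.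
  count-≤⇒↣ : {m : ℕ} {P : Pred (Fin n) 0ℓ} {Q : Pred (Fin m) 0ℓ} (P? : Decidable P) (Q? : Decidable Q) →
               Fin m → count P? ≤ count Q? → P ↣ Q
  count-≤⇒↣ {zero} P? Q? _ _ = record { to = λ (); to-∈ = λ {}; injective = λ {} }
  count-≤⇒↣ {suc n} P? Q? default P≤Q with P? zero
  ... | no ¬p = ↣-cons default (flip contradiction ¬p) id (flip contradiction ¬p)
                  (count-≤⇒↣ (P? ∘ suc) Q? default P≤Q)
  ... | yes _ with count-satisfiable Q? (≤-trans (s≤s z≤n) P≤Q)
  ...   | y₀ , q₀ = ↣-cons y₀ (const q₀) proj₁ (const proj₂)
                      (count-≤⇒↣ (P? ∘ suc) (Q? ∩? ∁? (_≟ y₀)) default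
                        (s≤s⁻¹ (≤-trans P≤Q (≤-reflexive (count-remove Q? q₀)))))

  module _ {m : ℕ} {P : Pred (Fin n) 0ℓ} {Q : Pred (Fin m) 0ℓ} (P? : Decidable P) (Q? : Decidable Q)
           (ℓ₁ : Fin n → ℕ) (ℓ₂ : Fin m → ℕ) where

    classwise-count-≤⇒↣ : Fin m → (∀ k → labelled P? ℓ₁ k ≤ labelled Q? ℓ₂ k) →
                          Σ[ f ∈ P ↣ Q ] (∀ {x} → P x → ℓ₂ (to f x) ≡ ℓ₁ x)
    classwise-count-≤⇒↣ default classes≤ =
      record { to = to′ ; to-∈ = proj₁ ∘ to′-∈ ; injective = to′-inj } , proj₂ ∘ to′-∈
      where
      class : ∀ k → (P ∩ λ x → ℓ₁ x ≡ k) ↣ (Q ∩ λ y → ℓ₂ y ≡ k)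
      class k = count-≤⇒↣ _ _ default (classes≤ k)
      to′ : Fin n → Fin m
      to′ x = to (class (ℓ₁ x)) x
      to′-∈ : ∀ {x} → P x → Q (to′ x) × ℓ₂ (to′ x) ≡ ℓ₁ x
      to′-∈ p = to-∈ (class _) (p , refl)
      to′-inj : ∀ {x y} → P x → P y → to′ x ≡ to′ y → x ≡ y
      to′-inj {x} {y} p q eq = injective (class (ℓ₁ x)) (p , refl) (q , sym same-label)
                                 (trans eq (cong (λ k → to (class k) y) (sym same-label)))
        where
        same-label : ℓ₁ x ≡ ℓ₁ y
        same-label = trans (sym (proj₂ (to′-∈ p))) (trans (cong ℓ₂ eq) (proj₂ (to′-∈ q)))

module Walk {n : ℕ} {D : Pred (Fin n) 0ℓ} (D? : Decidable D) (σ : Fin n → Fin n)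
            (σ-injective : ∀ {x y} → D x → D y → σ x ≡ σ y → x ≡ y) where

  open import Data.Nat using (zero; suc)
  open import Data.Nat.Properties using (≤-trans; ≤-reflexive; 1+n≰n)
  open import Data.Empty using (⊥-elim)
  open import Data.Sum using (_⊎_; inj₁; inj₂)
  open import Data.Product using (_×_; _,_; ∃; uncurry)
  open import Data.List using (List; []; _∷_; _++_; [_]; length; zip)
  open import Data.List.Relation.Unary.All using (All; []; _∷_)
  open import Data.List.Relation.Unary.Any using (here; there)
  open import Data.List.Membership.Propositional using (_∈_; _∉_)
  open import Data.List.Relation.Unary.Unique.Propositional using (Unique; []; _∷_)
  open import Data.List.Relation.Unary.All.Properties using (¬Any⇒All¬)
  open import Relation.Nullary using (¬_; yes; no; contradiction)
  open import Function using (_∘_)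
  open import Relation.Binary.PropositionalEquality using (_≢_; refl; sym; cong; subst)

  open Counting using (unique⇒length≤)

  -- walk k x follows σ from x for as long as it stays in D, but for at most k steps;
  -- Halts k x says that it was D, not the bound k, that ended it.
  mutual
    walk : ℕ → Fin n → List (Fin n)
    walk k x = x ∷ successors k x

    successors : ℕ → Fin n → List (Fin n)
    successors zero    x = []
    successors (suc k) x with D? x
    ... | yes _ = walk k (σ x)
    ... | no  _ = []

  Halts : ℕ → Fin n → Set
  Halts zero    x = ¬ D x
  Halts (suc k) x = D x → Halts k (σ x)

  Source : Fin n → Set
  Source x = ∀ {a} → D a → σ a ≢ x

  halts-or-length : ∀ k x → Halts k x ⊎ length (walk k x) ≡ suc k
  halts-or-length zero    x with D? x
  ... | yes _  = inj₂ refl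
  ... | no ¬d = inj₁ ¬d
  halts-or-length (suc k) x with D? x
  ... | no ¬d = inj₁ (λ d → contradiction d ¬d)
  ... | yes _ with halts-or-length k (σ x)
  ...   | inj₁ halts = inj₁ (λ _ → halts)
  ...   | inj₂ len   = inj₂ (cong suc len)

  walk-all : ∀ {P : Pred (Fin n) 0ℓ} k {x} → P x → (∀ {a} → D a → P (σ a)) → All P (walk k x)
  walk-all zero    p step = p ∷ []
  walk-all (suc k) {x} p step with D? x
  ... | yes d = p ∷ walk-all k (step d) step
  ... | no  _ = p ∷ []

  ∈-walk : ∀ k {x z} → z ∈ walk k x → z ≡ x ⊎ ∃ λ a → D a × a ∈ walk k x × σ a ≡ z
  ∈-walk k (here z≡x) = inj₁ z≡x
  ∈-walk (suc k) {x} (there z∈) with D? x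
  ... | yes d with ∈-walk k z∈
  ...   | inj₁ z≡σx               = inj₂ (x , d , here refl , sym z≡σx)
  ...   | inj₂ (a , da , a∈ , σa≡z) = inj₂ (a , da , there a∈ , σa≡z)

  σ-∈-walk : ∀ k {x a} → D a → σ a ∈ walk k x → σ a ≡ x ⊎ a ∈ walk k x
  σ-∈-walk k da σa∈ with ∈-walk k σa∈
  ... | inj₁ σa≡x                   = inj₁ σa≡x
  ... | inj₂ (a′ , da′ , a′∈ , σa′≡σa) =
    inj₂ (subst (_∈ walk k _) (σ-injective da′ da σa′≡σa) a′∈)

  walk-unique : ∀ k x → (∀ {a} → D a → a ∈ walk k x → σ a ≢ x) → Unique (walk k x)
  walk-unique zero    x _ = [] ∷ []
  walk-unique (suc k) x no-return with D? x
  ... | no  _ = [] ∷ []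
  ... | yes d = ¬Any⇒All¬ _ x∉ ∷ walk-unique k (σ x) no-return′
    where
    x∉ : x ∉ walk k (σ x)
    x∉ x∈ with ∈-walk k x∈
    ... | inj₁ x≡σx                 = no-return d (here refl) (sym x≡σx)
    ... | inj₂ (a , da , a∈ , σa≡x) = no-return da (there a∈) σa≡x
    no-return′ : ∀ {a} → D a → a ∈ walk k (σ x) → σ a ≢ σ x
    no-return′ da a∈ σa≡σx = x∉ (subst (_∈ walk k (σ x)) (σ-injective da d σa≡σx) a∈)

  source-walk-unique : ∀ k {x} → Source x → Unique (walk k x)
  source-walk-unique k {x} source = walk-unique k x (λ da _ → source da)

  source-halts : ∀ {x} → Source x → Halts n x
  source-halts {x} source with halts-or-length n x
  ... | inj₁ halts = halts
  ... | inj₂ len   = ⊥-elim (1+n≰n (≤-trans (≤-reflexive (sym len))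
                                              (unique⇒length≤ (source-walk-unique n source))))

  walk-meet : ∀ k k′ {x y z} → z ∈ walk k x → z ∈ walk k′ y → x ∈ walk k′ y ⊎ y ∈ walk k x
  walk-meet k k′ (here refl) z∈y = inj₁ z∈y
  walk-meet k k′ (there z∈x) (here refl) = inj₂ (there z∈x)
  walk-meet (suc k) (suc k′) {x} {y} (there z∈x) (there z∈y) with D? x | D? y
  ... | yes dx | yes dy with walk-meet k k′ z∈x z∈y
  ...   | inj₁ σx∈ with σ-∈-walk k′ dx σx∈
  ...     | inj₁ σx≡σy = inj₁ (here (σ-injective dx dy σx≡σy))
  ...     | inj₂ x∈    = inj₁ (there x∈)
  walk-meet (suc k) (suc k′) {x} {y} (there z∈x) (there z∈y) | yes dx | yes dy | inj₂ σy∈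
    with σ-∈-walk k dy σy∈
  ...     | inj₁ σy≡σx = inj₂ (here (σ-injective dy dx σy≡σx))
  ...     | inj₂ y∈    = inj₂ (there y∈)

  source-∈-walk : ∀ k {x y} → Source x → x ∈ walk k y → x ≡ y
  source-∈-walk k source x∈ with ∈-walk k x∈
  ... | inj₁ x≡y               = x≡y
  ... | inj₂ (_ , da , _ , σa≡x) = ⊥-elim (source da σa≡x)

  sources-walks-disjoint : ∀ k k′ {x y z} → Source x → Source y → x ≢ y →
                           z ∈ walk k x → z ∉ walk k′ y
  sources-walks-disjoint k k′ source-x source-y x≢y z∈x z∈y with walk-meet k k′ z∈x z∈y
  ... | inj₁ x∈ = x≢y (source-∈-walk k′ source-x x∈)
  ... | inj₂ y∈ = x≢y (sym (source-∈-walk k source-y y∈))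

  walk-closes : ∀ {R : Fin n → Fin n → Set} {w} k {x} → Halts k x →
                (∀ {a} → D a → R a (σ a)) → (∀ {z} → z ∈ walk k x → ¬ D z → R z w) →
                All (uncurry R) (zip (walk k x) (successors k x ++ [ w ]))
  walk-closes zero    halts step close = close (here refl) halts ∷ []
  walk-closes (suc k) {x} halts step close with D? x
  ... | yes d  = step d ∷ walk-closes k (halts d) step (close ∘ there)
  ... | no  ¬d = close (here refl) ¬d ∷ []

open Counting

open import Defs
open import Data.Nat using (ℕ; _≤_; _≥_; _+_; _∸_)
open import Data.Fin using (Fin)
open import Data.Fin.Subset using (Subset; _∈_; _∉_; _⊆_; _∩_; ∣_∣)
open import Data.List using (List)
open import Data.Product using (_×_; Σ)
open import Relation.Nullary using (¬_)
open import Relation.Binary.PropositionalEquality using (_≡_)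
import Data.List.Membership.Propositional as LM

open import Data.Nat using (suc; z≤n; s≤s; _≡ᵇ_; _≤?_) renaming (_≟_ to _≟ℕ_)
open import Data.Nat.Properties
  using (≡⇒≡ᵇ; ≡ᵇ⇒≡; ≤-trans; ≤-reflexive; ≤∧≢⇒<; +-mono-≤; +-monoˡ-≤; +-cancelˡ-≤; +-cancelˡ-≡;
         +-cancelʳ-≡; +-assoc; +-comm; +-commutativeSemigroup; m≤n+m∸n; module ≤-Reasoning)
open import Algebra.Properties.CommutativeSemigroup +-commutativeSemigroup
  using () renaming (interchange to +-interchange)
open import Data.Fin using () renaming (_≟_ to _≟ᶠ_)
open import Data.Fin.Subset using (Side; inside; outside)
open import Data.Fin.Subset.Properties using (_∈?_; drop-there; x∈p∩q⁺; x∈p∩q⁻)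
open import Data.Vec using ([]; _∷_; there)
open import Data.Vec.Properties using (lookup∘tabulate; []=⇒lookup; lookup⇒[]=)
open import Data.Bool using (true; false; T; if_then_else_)
open import Data.Empty using (⊥-elim)
open import Data.Product using (_,_; proj₁; proj₂; uncurry)
open import Data.Sum using (_⊎_; inj₁; inj₂)
open import Data.List using ([]; _∷_; _++_; [_]; zip)
open import Data.List.Relation.Unary.All as All using (All; []; _∷_)
open import Data.List.Relation.Unary.AllPairs using (AllPairs; []; _∷_)
open import Data.List.Relation.Unary.Unique.Propositional using (Unique)
open import Function using (_∘_; id)
open import Relation.Nullary using (yes; no; ¬?; does; contradiction; _×-dec_; _⊎-dec_)
import Relation.Unary as U
open import Relation.Unary.Properties using (_∩?_; ∁?)
open import Relation.Binary.PropositionalEquality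
  using (_≢_; refl; sym; trans; cong; cong₂; subst; subst₂; module ≡-Reasoning)

private
  N-entry : ∀ {n} → (Fin n → Fin n → ℕ) → ℕ → Fin n → Fin n → Side
  N-entry c j w y = if does (y ≟ᶠ w) then outside else (if does (c w y ≟ℕ j) then inside else outside)

-- does (m ≟ n) computes to m ≡ᵇ n, so the latter is what has to be abstracted.
∈N⁺ : ∀ {n} {c : Fin n → Fin n → ℕ} {j w y} → y ≢ w → c w y ≡ j → y ∈ N c j w
∈N⁺ {c = c} {j} {w} {y} y≢w cwy≡j
  with y ≟ᶠ w | c w y ≡ᵇ j in cwy≡ᵇj | lookup∘tabulate (N-entry c j w) y
... | yes y≡w | _     | _  = contradiction y≡w y≢w
... | no _    | true  | eq = lookup⇒[]= y _ eq
... | no _    | false | _  = ⊥-elim (subst T cwy≡ᵇj (≡⇒≡ᵇ _ _ cwy≡j))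

∈N⁻ : ∀ {n} {c : Fin n → Fin n → ℕ} {j w y} → y ∈ N c j w → y ≢ w × c w y ≡ j
∈N⁻ {c = c} {j} {w} {y} y∈N
  with y ≟ᶠ w | c w y ≡ᵇ j in cwy≡ᵇj | trans (sym (lookup∘tabulate (N-entry c j w) y)) ([]=⇒lookup y∈N)
... | no y≢w | true | _ = y≢w , ≡ᵇ⇒≡ _ _ (subst T (sym cwy≡ᵇj) _)

∣p∣≡count : ∀ {n} {P : Pred (Fin n) 0ℓ} (p : Subset n) (P? : Decidable P) →
            (∀ {y} → y ∈ p → P y) → (∀ {y} → P y → y ∈ p) → ∣ p ∣ ≡ count P?
∣p∣≡count p P? p⊆P P⊆p = trans (∣p∣≡count-∈ p) (count-cong (_∈? p) P? (p⊆P , P⊆p))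
  where
  ∣p∣≡count-∈ : ∀ {n} (p : Subset n) → ∣ p ∣ ≡ count (_∈? p)
  ∣p∣≡count-∈ [] = refl
  ∣p∣≡count-∈ (inside  ∷ p) = cong suc (trans (∣p∣≡count-∈ p) (count-cong (_∈? p) _ (there , drop-there)))
  ∣p∣≡count-∈ (outside ∷ p) =          trans (∣p∣≡count-∈ p) (count-cong (_∈? p) _ (there , drop-there))

Avoids : ∀ {n} → Fin n → Fin n → Fin n → Set
Avoids u v y = y ≢ u × y ≢ v

module _ {n : ℕ} {u v : Fin n} where

  exchangeEdges-All : ∀ {P : Fin n → Set} {Q : Edge n → Set} {ys} →
                      (∀ {y} → P y → Q (v , y) × Q (y , u)) → All P ys → All Q (exchangeEdges u v ys)
  exchangeEdges-All f []       = []
  exchangeEdges-All f (p ∷ ps) = proj₁ (f p) ∷ proj₂ (f p) ∷ exchangeEdges-All f ps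

  exchangeEdges-edges : ∀ {ys} → All (Avoids u v) ys → All IsEdge (exchangeEdges u v ys)
  exchangeEdges-edges = exchangeEdges-All λ (y≢u , y≢v) → y≢v ∘ sym , y≢u

  exchangeEdges-distinct : u ≢ v → ∀ {ys} → All (Avoids u v) ys → Unique ys →
                           AllPairs (λ e f → ¬ SameEdge e f) (exchangeEdges u v ys)
  exchangeEdges-distinct u≢v [] [] = []
  exchangeEdges-distinct u≢v {y ∷ ys} ((y≢u , y≢v) ∷ avoid) (y∉ys ∷ unique) =
      (vy≠yu ∷ exchangeEdges-All (λ p → vy≠vy′ p , vy≠y′u p) (All.zip (y∉ys , avoid)))
    ∷ exchangeEdges-All (λ p → yu≠vy′ p , yu≠y′u p) (All.zip (y∉ys , avoid))
    ∷ exchangeEdges-distinct u≢v avoid unique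
    where
    vy≠yu : ¬ SameEdge (v , y) (y , u)
    vy≠yu (inj₁ (v≡y , _)) = y≢v (sym v≡y)
    vy≠yu (inj₂ (v≡u , _)) = u≢v (sym v≡u)
    vy≠vy′ : ∀ {y′} → y ≢ y′ × Avoids u v y′ → ¬ SameEdge (v , y) (v , y′)
    vy≠vy′ (y≢y′ , _)       (inj₁ (_ , y≡y′)) = y≢y′ y≡y′
    vy≠vy′ (_ , (_ , y′≢v)) (inj₂ (v≡y′ , _)) = y′≢v (sym v≡y′)
    vy≠y′u : ∀ {y′} → y ≢ y′ × Avoids u v y′ → ¬ SameEdge (v , y) (y′ , u)
    vy≠y′u (_ , (_ , y′≢v)) (inj₁ (v≡y′ , _)) = y′≢v (sym v≡y′)
    vy≠y′u _                (inj₂ (v≡u , _))  = u≢v (sym v≡u)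
    yu≠vy′ : ∀ {y′} → y ≢ y′ × Avoids u v y′ → ¬ SameEdge (y , u) (v , y′)
    yu≠vy′ _ (inj₁ (y≡v , _)) = y≢v y≡v
    yu≠vy′ _ (inj₂ (_ , u≡v)) = u≢v u≡v
    yu≠y′u : ∀ {y′} → y ≢ y′ × Avoids u v y′ → ¬ SameEdge (y , u) (y′ , u)
    yu≠y′u (y≢y′ , _) (inj₁ (y≡y′ , _)) = y≢y′ y≡y′
    yu≠y′u _          (inj₂ (y≡u , _))  = y≢u y≡u

  isExchange⁺ : (c : Fin n → Fin n → ℕ) → u ≢ v → ∀ x ys →
                All (Avoids u v) (x ∷ ys) → Unique (x ∷ ys) →
                All (uncurry λ a b → c a u ≡ c v b) (zip (x ∷ ys) (ys ++ [ x ])) →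
                IsExchange c u v x (x ∷ ys)
  isExchange⁺ c u≢v x ys avoid unique colours =
    refl , exchangeEdges-edges avoid , exchangeEdges-distinct u≢v avoid unique , colours

module ColourClasses {n t : ℕ} {c : Fin n → Fin n → ℕ} (colouring : IsEdgeColouring n t c)
                     {u v : Fin n} (u≢v : u ≢ v) where

  colᵤ colᵥ : Fin n → ℕ
  colᵤ y = c y u
  colᵥ y = c v y

  avoids? : Decidable (Avoids u v)
  avoids? y = ¬? (y ≟ᶠ u) ×-dec ¬? (y ≟ᶠ v)

  #ᵤ #ᵥ : ℕ → ℕ
  #ᵤ = labelled avoids? colᵤ
  #ᵥ = labelled avoids? colᵥ

  colᵤ-range : ∀ {y} → Avoids u v y → 1 ≤ colᵤ y × colᵤ y ≤ t
  colᵤ-range (y≢u , _) = proj₂ colouring _ u y≢u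

  colᵥ-range : ∀ {y} → Avoids u v y → 1 ≤ colᵥ y × colᵥ y ≤ t
  colᵥ-range (_ , y≢v) = proj₂ colouring v _ (y≢v ∘ sym)

  neighbour? : ∀ j w → Decidable (λ y → y ≢ w × c w y ≡ j)
  neighbour? j w y = ¬? (y ≟ᶠ w) ×-dec (c w y ≟ℕ j)

  deg≡count : ∀ j w → deg c j w ≡ count (neighbour? j w)
  deg≡count j w =
    ∣p∣≡count (N c j w) (neighbour? j w) (∈N⁻ {c = c}) (λ (y≢w , cwy≡j) → ∈N⁺ {c = c} y≢w cwy≡j)

  uv-edge : ℕ → ℕ
  uv-edge j = count (neighbour? j u ∩? (_≟ᶠ v))

  deg-u : ∀ j → deg c j u ≡ uv-edge j + #ᵤ j
  deg-u j = trans (deg≡count j u) (trans (count-split (neighbour? j u) (_≟ᶠ v))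
    (cong (uv-edge j +_) (count-cong (neighbour? j u ∩? ∁? (_≟ᶠ v)) (avoids? ∩? λ y → colᵤ y ≟ℕ j)
      ( (λ ((y≢u , cuy≡j) , y≢v) → (y≢u , y≢v) , trans (proj₁ colouring _ u) cuy≡j)
      , (λ ((y≢u , y≢v) , cyu≡j) → (y≢u , trans (proj₁ colouring u _) cyu≡j) , y≢v)))))

  deg-v : ∀ j → deg c j v ≡ uv-edge j + #ᵥ j
  deg-v j = trans (deg≡count j v) (trans (count-split (neighbour? j v) (_≟ᶠ u))
    (cong₂ _+_
      (count-point-cong (neighbour? j v) (neighbour? j u)
        (λ (u≢v , cvu≡j) → (u≢v ∘ sym) , trans (proj₁ colouring u v) cvu≡j)
        (λ (v≢u , cuv≡j) → (v≢u ∘ sym) , trans (proj₁ colouring v u) cuv≡j))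
      (count-cong (neighbour? j v ∩? ∁? (_≟ᶠ u)) (avoids? ∩? λ y → colᵥ y ≟ℕ j)
        ( (λ ((y≢v , cvy≡j) , y≢u) → (y≢u , y≢v) , cvy≡j)
        , (λ ((y≢u , y≢v) , cvy≡j) → (y≢v , cvy≡j) , y≢u)))))

  module _ (regular : ∀ j → 3 ≤ j → j ≤ t → Regular c j) where

    class-balance : ∀ {j} → j ≢ 1 → j ≢ 2 → #ᵤ j ≡ #ᵥ j
    class-balance {j} j≢1 j≢2 with (3 ≤? j) ×-dec (j ≤? t)
    ... | yes (3≤j , j≤t) with regular j 3≤j j≤t
    ...   | d , deg≡d = +-cancelˡ-≡ (uv-edge j) _ _
                          (trans (sym (deg-u j)) (trans (deg≡d u) (trans (sym (deg≡d v)) (deg-v j))))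
    class-balance {j} j≢1 j≢2 | no out-of-range =
      trans (count-empty (avoids? ∩? λ y → colᵤ y ≟ℕ j)
               λ _ (avoid , colᵤy≡j) → out-of-range (in-range colᵤy≡j (colᵤ-range avoid)))
        (sym (count-empty (avoids? ∩? λ y → colᵥ y ≟ℕ j)
               λ _ (avoid , colᵥy≡j) → out-of-range (in-range colᵥy≡j (colᵥ-range avoid))))
      where
      in-range : ∀ {k} → k ≡ j → 1 ≤ k × k ≤ t → 3 ≤ j × j ≤ t
      in-range refl (1≤j , j≤t) = ≤∧≢⇒< (≤∧≢⇒< 1≤j (j≢1 ∘ sym)) (j≢2 ∘ sym) , j≤t

    private
      Others : (Fin n → ℕ) → Pred (Fin n) 0ℓ
      Others col = (Avoids u v U.∩ U.∁ (λ y → col y ≡ 1)) U.∩ U.∁ (λ y → col y ≡ 2)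

      others? : ∀ col → Decidable (Others col)
      others? col = (avoids? ∩? ∁? λ y → col y ≟ℕ 1) ∩? ∁? λ y → col y ≟ℕ 2

      count-split-1-2 : ∀ col → count avoids? ≡ labelled avoids? col 1 + (labelled avoids? col 2 + count (others? col))
      count-split-1-2 col = trans (count-split avoids? λ y → col y ≟ℕ 1)
        (cong (labelled avoids? col 1 +_) (trans (count-split (avoids? ∩? ∁? λ y → col y ≟ℕ 1) λ y → col y ≟ℕ 2)
          (cong (_+ count (others? col)) (labelled-∖-other avoids? col λ ()))))

      others-balance : count (others? colᵤ) ≡ count (others? colᵥ)
      others-balance = count-≡-by-label (others? colᵤ) (others? colᵥ) colᵤ colᵥ (suc t)
        (λ ((avoid , _) , _) → s≤s (proj₂ (colᵤ-range avoid)))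
        (λ ((avoid , _) , _) → s≤s (proj₂ (colᵥ-range avoid)))
        classes
        where
        labelled-others-1 : ∀ col → labelled (others? col) col 1 ≡ 0
        labelled-others-1 col = trans (labelled-∖-other (avoids? ∩? ∁? λ y → col y ≟ℕ 1) col λ ())
                                      (labelled-∖-same avoids? col)
        labelled-others-2 : ∀ col → labelled (others? col) col 2 ≡ 0
        labelled-others-2 col = labelled-∖-same (avoids? ∩? ∁? λ y → col y ≟ℕ 1) col
        labelled-others : ∀ col {k} → k ≢ 1 → k ≢ 2 → labelled (others? col) col k ≡ labelled avoids? col k
        labelled-others col k≢1 k≢2 = trans (labelled-∖-other (avoids? ∩? ∁? λ y → col y ≟ℕ 1) col k≢2)
                                            (labelled-∖-other avoids? col k≢1)
        classes : ∀ k → labelled (others? colᵤ) colᵤ k ≡ labelled (others? colᵥ) colᵥ k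
        classes k with k ≟ℕ 1 | k ≟ℕ 2
        ... | yes refl | _        = trans (labelled-others-1 colᵤ) (sym (labelled-others-1 colᵥ))
        ... | no _     | yes refl = trans (labelled-others-2 colᵤ) (sym (labelled-others-2 colᵥ))
        ... | no k≢1   | no k≢2   = trans (labelled-others colᵤ k≢1 k≢2)
                                      (trans (class-balance k≢1 k≢2) (sym (labelled-others colᵥ k≢1 k≢2)))

    two-colour-balance : #ᵤ 1 + #ᵤ 2 ≡ #ᵥ 1 + #ᵥ 2
    two-colour-balance = +-cancelʳ-≡ (count (others? colᵤ)) _ _ (begin
      (#ᵤ 1 + #ᵤ 2) + count (others? colᵤ) ≡⟨ +-assoc (#ᵤ 1) _ _ ⟩
      #ᵤ 1 + (#ᵤ 2 + count (others? colᵤ)) ≡⟨ count-split-1-2 colᵤ ⟨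
      count avoids?                        ≡⟨ count-split-1-2 colᵥ ⟩
      #ᵥ 1 + (#ᵥ 2 + count (others? colᵥ)) ≡⟨ +-assoc (#ᵥ 1) _ _ ⟨
      (#ᵥ 1 + #ᵥ 2) + count (others? colᵥ) ≡⟨ cong ((#ᵥ 1 + #ᵥ 2) +_) others-balance ⟨
      (#ᵥ 1 + #ᵥ 2) + count (others? colᵤ) ∎)
      where open ≡-Reasoning

module Exchanges {n t : ℕ} {c : Fin n → Fin n → ℕ} (colouring : IsEdgeColouring n t c)
                 (regular : ∀ j → 3 ≤ j → j ≤ t → Regular c j)
                 {u v : Fin n} (u≢v : u ≢ v)
                 {X : Subset n} (X⊆N₁v : X ⊆ N c 1 v) (u∉X : u ∉ X)
                 (hyp : deg c 1 u ≥ (deg c 1 v ∸ ∣ N c 2 u ∩ N c 1 v ∣) + ∣ X ∩ N c 2 u ∣) where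

  open ColourClasses colouring u≢v

  -- Every vertex of a walk after its start is σ a with colᵤ a ≢ 1, so has colᵥ ≢ 1; walks stop at colᵤ ≡ 1.
  Domain : Pred (Fin n) 0ℓ
  Domain y = Avoids u v y × colᵤ y ≢ 1 × (y ∈ X ⊎ colᵥ y ≢ 1)

  domain? : Decidable Domain
  domain? y = avoids? y ×-dec ¬? (colᵤ y ≟ℕ 1) ×-dec ((y ∈? X) ⊎-dec ¬? (colᵥ y ≟ℕ 1))

  domain-colour-2 : labelled domain? colᵤ 2 ≤ #ᵥ 2
  domain-colour-2 = ≤-trans domain₂≤
    (arithmetic {a = ∣ N c 2 u ∩ N c 1 v ∣} {x = ∣ X ∩ N c 2 u ∣}
                hyp′ (two-colour-balance regular) #ᵤ2-split)
    where
    A₂ = avoids? ∩? λ y → colᵤ y ≟ℕ 2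
    D₂ = domain? ∩? λ y → colᵤ y ≟ℕ 2
    rest₂ = count (A₂ ∩? ∁? λ y → colᵥ y ≟ℕ 1)

    hyp′ : (uv-edge 1 + #ᵥ 1 ∸ ∣ N c 2 u ∩ N c 1 v ∣) + ∣ X ∩ N c 2 u ∣ ≤ uv-edge 1 + #ᵤ 1
    hyp′ = subst₂ (λ d d′ → (d ∸ ∣ N c 2 u ∩ N c 1 v ∣) + ∣ X ∩ N c 2 u ∣ ≤ d′)
                  (deg-v 1) (deg-u 1) hyp

    #ᵤ2-split : #ᵤ 2 ≡ ∣ N c 2 u ∩ N c 1 v ∣ + rest₂
    #ᵤ2-split = trans (count-split A₂ λ y → colᵥ y ≟ℕ 1) (cong (_+ rest₂) (sym
      (∣p∣≡count (N c 2 u ∩ N c 1 v) (A₂ ∩? λ y → colᵥ y ≟ℕ 1)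
        (λ y∈ → let (y≢u , cuy≡2) = ∈N⁻ {c = c} (proj₁ (x∈p∩q⁻ _ _ y∈))
                    (y≢v , cvy≡1) = ∈N⁻ {c = c} (proj₂ (x∈p∩q⁻ _ _ y∈))
                in ((y≢u , y≢v) , trans (proj₁ colouring _ u) cuy≡2) , cvy≡1)
        (λ (((y≢u , y≢v) , cyu≡2) , cvy≡1) →
           x∈p∩q⁺ (∈N⁺ {c = c} y≢u (trans (proj₁ colouring u _) cyu≡2) , ∈N⁺ {c = c} y≢v cvy≡1)))))

    into-X∩N₂u : ∀ {y} → (Domain y × colᵤ y ≡ 2) × colᵥ y ≡ 1 → y ∈ X ∩ N c 2 u
    into-X∩N₂u (((_ , _ , inj₂ cvy≢1) , _) , cvy≡1) = contradiction cvy≡1 cvy≢1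
    into-X∩N₂u ((((y≢u , _) , _ , inj₁ y∈X) , cyu≡2) , _) =
      x∈p∩q⁺ (y∈X , ∈N⁺ {c = c} y≢u (trans (proj₁ colouring u _) cyu≡2))

    domain₂≤ : labelled domain? colᵤ 2 ≤ ∣ X ∩ N c 2 u ∣ + rest₂
    domain₂≤ = ≤-trans (≤-reflexive (count-split D₂ λ y → colᵥ y ≟ℕ 1)) (+-mono-≤
      (≤-trans (count-mono (D₂ ∩? λ y → colᵥ y ≟ℕ 1) (_∈? (X ∩ N c 2 u)) into-X∩N₂u)
               (≤-reflexive (sym (∣p∣≡count (X ∩ N c 2 u) (_∈? (X ∩ N c 2 u)) id id))))
      (count-mono (D₂ ∩? ∁? λ y → colᵥ y ≟ℕ 1) (A₂ ∩? ∁? λ y → colᵥ y ≟ℕ 1)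
        λ (((avoid , _) , cyu≡2) , cvy≢1) → (avoid , cyu≡2) , cvy≢1))

    arithmetic : ∀ {e h₁ h₁′ h₂ h₂′ a x b} → (e + h₁′ ∸ a) + x ≤ e + h₁ →
                 h₁ + h₂ ≡ h₁′ + h₂′ → h₂ ≡ a + b → x + b ≤ h₂′
    arithmetic {e} {h₁} {h₁′} {h₂} {h₂′} {a} {x} {b} hyp sum split = +-cancelˡ-≤ (e + h₁′) _ _ (begin
      (e + h₁′) + (x + b)           ≤⟨ +-monoˡ-≤ (x + b) (m≤n+m∸n (e + h₁′) a) ⟩
      (a + (e + h₁′ ∸ a)) + (x + b) ≡⟨ cong (_+ (x + b)) (+-comm a (e + h₁′ ∸ a)) ⟩
      ((e + h₁′ ∸ a) + a) + (x + b) ≡⟨ +-interchange (e + h₁′ ∸ a) a x b ⟩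
      (e + h₁′ ∸ a + x) + (a + b)   ≤⟨ +-monoˡ-≤ (a + b) hyp ⟩
      (e + h₁) + (a + b)            ≡⟨ cong ((e + h₁) +_) split ⟨
      (e + h₁) + h₂                 ≡⟨ +-assoc e h₁ h₂ ⟩
      e + (h₁ + h₂)                 ≡⟨ cong (e +_) sum ⟩
      e + (h₁′ + h₂′)               ≡⟨ +-assoc e h₁′ h₂′ ⟨
      (e + h₁′) + h₂′               ∎)
      where open ≤-Reasoning

  domain-class-bound : ∀ k → labelled domain? colᵤ k ≤ #ᵥ k
  domain-class-bound k with k ≟ℕ 1 | k ≟ℕ 2
  ... | yes refl | _        = ≤-trans (≤-reflexive (count-empty (domain? ∩? λ y → colᵤ y ≟ℕ 1)
                                λ _ ((_ , cyu≢1 , _) , cyu≡1) → cyu≢1 cyu≡1)) z≤n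
  ... | no _     | yes refl = domain-colour-2
  ... | no k≢1   | no k≢2   = ≤-trans (count-mono (domain? ∩? λ y → colᵤ y ≟ℕ k) (avoids? ∩? λ y → colᵤ y ≟ℕ k)
                                       λ ((avoid , _) , cyu≡k) → avoid , cyu≡k)
                                     (≤-reflexive (class-balance regular k≢1 k≢2))

  successor : Σ (Domain ↣ Avoids u v) λ σ → ∀ {x} → Domain x → colᵥ (to σ x) ≡ colᵤ x
  successor = classwise-count-≤⇒↣ domain? avoids? colᵤ colᵥ u domain-class-bound

  σ : Fin n → Fin n
  σ = to (proj₁ successor)

  open Walk domain? σ (injective (proj₁ successor)) public

  OnWalk : Fin n → Set
  OnWalk y = Avoids u v y × (y ∈ X ⊎ colᵥ y ≢ 1)

  colᵥ-X : ∀ {x} → x ∈ X → colᵥ x ≡ 1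
  colᵥ-X x∈X = proj₂ (∈N⁻ {c = c} (X⊆N₁v x∈X))

  X-onWalk : ∀ {x} → x ∈ X → OnWalk x
  X-onWalk {x} x∈X =
    ((λ x≡u → u∉X (subst (_∈ X) x≡u x∈X)) , proj₁ (∈N⁻ {c = c} (X⊆N₁v x∈X))) , inj₁ x∈X

  σ-onWalk : ∀ {a} → Domain a → OnWalk (σ a)
  σ-onWalk da@(_ , cau≢1 , _) =
    to-∈ (proj₁ successor) da , inj₂ λ colᵥσa≡1 → cau≢1 (trans (sym (proj₂ successor da)) colᵥσa≡1)

  X-source : ∀ {x} → x ∈ X → Source x
  X-source x∈X da@(_ , cau≢1 , _) σa≡x =
    cau≢1 (trans (sym (proj₂ successor da)) (trans (cong colᵥ σa≡x) (colᵥ-X x∈X)))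

  onWalk-halt : ∀ {z} → OnWalk z → ¬ Domain z → colᵤ z ≡ 1
  onWalk-halt {z} (avoid , side) ¬dz with colᵤ z ≟ℕ 1
  ... | yes czu≡1 = czu≡1
  ... | no  czu≢1 = contradiction (avoid , czu≢1 , side) ¬dz

  X-exchange : ∀ {x} → x ∈ X → IsExchange c u v x (walk n x)
  X-exchange {x} x∈X = isExchange⁺ c u≢v x (successors n x) (All.map proj₁ onWalk) (source-walk-unique n source)
    (walk-closes n (source-halts source) (λ da → sym (proj₂ successor da))
      λ z∈ ¬dz → trans (onWalk-halt (All.lookup onWalk z∈) ¬dz) (sym (colᵥ-X x∈X)))
    where
    source = X-source x∈X
    onWalk = walk-all n (X-onWalk x∈X) σ-onWalk

lemma3p4 : (n t : ℕ) → 2 ≤ t → (c : Fin n → Fin n → ℕ) → IsEdgeColouring n t c →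
    (∀ j → 3 ≤ j → j ≤ t → Regular c j) →
    (u v : Fin n) → ¬ u ≡ v →
    (X : Subset n) → X ⊆ N c 1 v → (∀ x → x ∈ X → x ∉ N c 1 u) → u ∉ X →
    deg c 1 u ≥ (deg c 1 v ∸ ∣ N c 2 u ∩ N c 1 v ∣) + ∣ X ∩ N c 2 u ∣ →
    Σ ((x : Fin n) → x ∈ X → List (Fin n)) λ L →
    (∀ x (x∈X : x ∈ X) → IsExchange c u v x (L x x∈X)) ×
    (∀ x y (x∈X : x ∈ X) (y∈X : y ∈ X) → ¬ x ≡ y →
    ∀ z → z LM.∈ L x x∈X → ¬ (z LM.∈ L y y∈X))
lemma3p4 n t _ c colouring regular u v u≢v X X⊆N₁v _ u∉X hyp =
  (λ x _ → walk n x) , (λ _ → X-exchange) ,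
  λ _ _ x∈X y∈X x≢y _ → sources-walks-disjoint n n (X-source x∈X) (X-source y∈X) x≢y
  where open Exchanges colouring regular u≢v X⊆N₁v u∉X hyp
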